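{- Let $G=(V,E)$ be an undirected graph and $A,C\subseteq V$. Suppose $A$ $\phi$-expands in $G$, and there exists a flow in $G$ routable with congestion $c$ in which each vertex $v\in C$ sends $1$ unit of flow and each vertex $u\in A$ receives at most $a$ units (all flow being delivered to vertices of $A$). Then $A\cup C$ $\frac{\phi}{2(a+1+c\phi)}$-expands in $G$.
   Context: For a graph $H=(W,E_H)$ with unit edge capacities and $A\subseteq W$, $A$ $\alpha$-expands in $H$ if for every $U\subseteq W$ with $\min(|A\cap U|,|A\setminus U|)>0$, the number of edges crossing $(U,W\setminus U)$ is at least $\alpha\min(|A\cap U|,|A\setminus U|)$. The congestion of a flow is the maximum over edges of the total flow through the edge divided by its capacity. -}

module Defs where

open import Data.Bool using (Bool; true; false; if_then_else_; _xor_)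
open import Data.Nat as ℕ using (ℕ; zero; suc)
open import Data.Integer using (+_)
open import Data.Fin using (Fin)
open import Data.Fin.Subset using (Subset; _∩_; _─_; ∣_∣; _∉_)
open import Data.Vec using (lookup)
open import Data.Product using (_×_; proj₁; proj₂)
open import Data.Rational using (ℚ; 0ℚ; 1ℚ; _+_; _-_; _*_; _÷_; _≤_; NonZero; Positive; NonNegative; _/_; nonNegative)
import Data.Rational as Q
open import Data.Rational.Properties
  using (pos⇒nonZero; pos*pos⇒pos; nonNeg+pos⇒pos; pos+nonNeg⇒pos; nonNeg*nonNeg⇒nonNeg)
open import Relation.Binary.PropositionalEquality using (_≡_)

-- A (multi)graph on vertex set Fin n with m edges; edge e has endpoints
-- ends e = (x , y).  Every edge has unit capacity.  Self-loops never cross a cut.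

ℕ→ℚ : ℕ → ℚ
ℕ→ℚ k = + k / 1

∑ : ∀ {m} → (Fin m → ℚ) → ℚ
∑ {zero}  f = 0ℚ
∑ {suc m} f = f Fin.zero + ∑ (λ i → f (Fin.suc i))
  where import Data.Fin as Fin

count : ∀ {m} → (Fin m → Bool) → ℕ
count {zero}  p = 0
count {suc m} p = (if p Data.Fin.zero then 1 else 0) ℕ.+ count (λ i → p (Data.Fin.suc i))
  where import Data.Fin

cut : ∀ {n m} → (Fin m → Fin n × Fin n) → Subset n → ℕ
cut ends U = count (λ e → lookup U (proj₁ (ends e)) xor lookup U (proj₂ (ends e)))

Expands : ∀ {n m} → (Fin m → Fin n × Fin n) → ℚ → Subset n → Set
Expands {n} ends α A =
  (U : Subset n) →
  0 ℕ.< (∣ A ∩ U ∣ ℕ.⊓ ∣ A ─ U ∣) →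
  α * ℕ→ℚ (∣ A ∩ U ∣ ℕ.⊓ ∣ A ─ U ∣) ≤ ℕ→ℚ (cut ends U)

-- net flow out of v for a signed edge flow f (f e > 0 means flow from proj₁ to proj₂)
netOut : ∀ {n m} → (Fin m → Fin n × Fin n) → (Fin m → ℚ) → Fin n → ℚ
netOut ends f v =
  ∑ (λ e → if Data.Fin._≟_ (proj₁ (ends e)) v .Relation.Nullary.Decidable.does then f e else 0ℚ)
  - ∑ (λ e → if Data.Fin._≟_ (proj₂ (ends e)) v .Relation.Nullary.Decidable.does then f e else 0ℚ)
  where import Data.Fin
        import Relation.Nullary.Decidable

-- A flow in the graph in which each vertex of C sends 1 unit, and each vertex
-- u ∈ A receives recv u ∈ [0 , a] units (vertices outside A receive nothing),
-- routed with congestion c (unit capacities: |flow on e| ≤ c).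
record CAFlow {n m} (ends : Fin m → Fin n × Fin n) (A C : Subset n) (a c : ℚ) : Set where
  field
    flow       : Fin m → ℚ
    recv       : Fin n → ℚ
    recv-nonneg : ∀ v → 0ℚ ≤ recv v
    recv-≤a     : ∀ v → recv v ≤ a
    recv-in-A   : ∀ v → v ∉ A → recv v ≡ 0ℚ
    conservation : ∀ v → netOut ends flow v ≡ (if lookup C v then 1ℚ else 0ℚ) - recv v
    congestion  : ∀ e → Q.∣ flow e ∣ ≤ c

denom : ℚ → ℚ → ℚ → ℚ
denom φ a c = (+ 2 / 1) * (a + 1ℚ + c * φ)

denom-pos : ∀ φ a c → 0ℚ ≤ φ → 0ℚ ≤ a → 0ℚ ≤ c → Positive (denom φ a c)
denom-pos φ a c hφ ha hc =
  pos*pos⇒pos (+ 2 / 1) (a + 1ℚ + c * φ)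
    {{pos+nonNeg⇒pos (a + 1ℚ) {{nonNeg+pos⇒pos a {{nonNegative ha}} 1ℚ}} (c * φ)
       {{nonNeg*nonNeg⇒nonNeg c {{nonNegative hc}} φ {{nonNegative hφ}}}}}}

rate : (φ a c : ℚ) → 0ℚ ≤ φ → 0ℚ ≤ a → 0ℚ ≤ c → ℚ
rate φ a c hφ ha hc = _÷_ φ (denom φ a c) {{pos⇒nonZero (denom φ a c) {{denom-pos φ a c hφ ha hc}}}}

{-# OPTIONS --safe #-}
module Submission where

-- Fix a cut (U , V ∖ U) with δ crossing edges and let W be the side holding fewer vertices
-- of A, so that φ ∣A ∩ W∣ ≤ δ.  Each vertex of C ∩ W emits one unit of flow, which is either
-- absorbed inside W, by A ∩ W at a units per vertex, or leaves W across the cut, which carries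
-- at most c δ.  Hence ∣C ∩ W∣ ≤ a ∣A ∩ W∣ + c δ and
--   φ ∣(A ∪ C) ∩ W∣ ≤ (1 + a) φ ∣A ∩ W∣ + c φ δ ≤ (a + 1 + c φ) δ,
-- which bounds the smaller side of (A ∪ C); the factor 2 in the rate is slack.

open import Defs
open import Function using (_∘_)
open import Data.Bool using (Bool; true; false; not; _∧_; _xor_; if_then_else_)
open import Data.Bool.Properties using (∧-zeroʳ; ∧-identityʳ; not-distribˡ-xor; not-distribʳ-xor; not-involutive)
open import Data.Nat as ℕ using (ℕ; zero; suc; z≤n; s≤s; _⊓_)
import Data.Nat.Properties as ℕ
import Data.Integer as ℤ
import Data.Integer.Properties as ℤ
open import Data.Fin using (Fin) renaming (zero to 0F; suc to 1+)
open import Data.Fin.Properties using (_≟_)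
open import Data.Fin.Subset using (Subset; _∩_; _∪_; _─_; ∁; ∣_∣; _∉_)
open import Data.Fin.Subset.Properties using (∩-distribʳ-∪)
open import Data.Vec using ([]; _∷_; lookup)
open import Data.Vec.Properties using (lookup-map; lookup-zipWith; []=⇒lookup)
open import Data.Product using (_×_; _,_; proj₁; proj₂)
open import Data.Sum using (inj₁; inj₂)
open import Data.Rational as ℚ using (ℚ; mkℚ; _/_; 0ℚ; 1ℚ; _+_; _-_; -_; _*_; _≤_; 1/_; NonNegative; nonNegative)
open import Data.Rational.Properties hiding (_≟_)
open import Data.Rational.Solver using (module +-*-Solver)
open import Data.Nat.Coprimality using (1-coprimeTo) renaming (sym to coprime-sym)
open import Algebra.Properties.CommutativeMonoid.Sum +-0-commutativeMonoid
  using (sum; sum-cong-≗; ∑-distrib-+; ∑-comm; sum-replicate-zero)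
open import Algebra.Bundles using (Ring; CommutativeMonoid)
open import Algebra.Properties.Semiring.Sum (Ring.semiring +-*-ring) using (*-distribˡ-sum; *-distribʳ-sum)
open import Algebra.Properties.CommutativeSemigroup (CommutativeMonoid.commutativeSemigroup *-1-commutativeMonoid)
  using (x∙yz≈y∙xz)
open import Algebra.Properties.Ring +-*-ring using (x[y-z]≈xy-xz; [y-z]x≈yx-zx; -1*x≈-x)
open import Relation.Nullary.Decidable using (does)
open import Relation.Binary.PropositionalEquality

ℕ→ℚ-+ : ∀ m n → ℕ→ℚ (m ℕ.+ n) ≡ ℕ→ℚ m + ℕ→ℚ n
ℕ→ℚ-+ m n = begin
  ℤ.+ (m ℕ.+ n) / 1                          ≡⟨ cong (_/ 1) numerators ⟨
  (ℤ.+ m ℤ.* ℤ.+ 1 ℤ.+ ℤ.+ n ℤ.* ℤ.+ 1) / 1  ≡⟨ cong₂ _+_ (ℕ→ℚ≡mkℚ m) (ℕ→ℚ≡mkℚ n) ⟨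
  ℕ→ℚ m + ℕ→ℚ n                              ∎
  where
  open ≡-Reasoning
  -- the normal form of k / 1, on which _+_ computes to the middle line of the chain
  ℕ→ℚ≡mkℚ : ∀ k → ℕ→ℚ k ≡ mkℚ (ℤ.+ k) 0 (coprime-sym (1-coprimeTo k))
  ℕ→ℚ≡mkℚ k = normalize-coprime (coprime-sym (1-coprimeTo k))
  numerators : ℤ.+ m ℤ.* ℤ.+ 1 ℤ.+ ℤ.+ n ℤ.* ℤ.+ 1 ≡ ℤ.+ (m ℕ.+ n)
  numerators = cong₂ ℤ._+_ (ℤ.*-identityʳ (ℤ.+ m)) (ℤ.*-identityʳ (ℤ.+ n))

ℕ→ℚ-nonNeg : ∀ k → 0ℚ ≤ ℕ→ℚ k
ℕ→ℚ-nonNeg k = nonNegative⁻¹ (ℕ→ℚ k) {{normalize-nonNeg k 1}}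

ℕ→ℚ-mono-≤ : ∀ {m n} → m ℕ.≤ n → ℕ→ℚ m ≤ ℕ→ℚ n
ℕ→ℚ-mono-≤ {m} m≤n with ℕ.m≤n⇒∃[o]m+o≡n m≤n
... | o , refl = begin
  ℕ→ℚ m            ≡⟨ +-identityʳ (ℕ→ℚ m) ⟨
  ℕ→ℚ m + 0ℚ       ≤⟨ +-monoʳ-≤ (ℕ→ℚ m) (ℕ→ℚ-nonNeg o) ⟩
  ℕ→ℚ m + ℕ→ℚ o    ≡⟨ ℕ→ℚ-+ m o ⟨
  ℕ→ℚ (m ℕ.+ o)    ∎
  where open ≤-Reasoning

p≤∣p∣ : ∀ p → p ≤ ℚ.∣ p ∣
p≤∣p∣ p with ≤-total 0ℚ p
... | inj₁ 0≤p = ≤-reflexive (sym (0≤p⇒∣p∣≡p 0≤p))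
... | inj₂ p≤0 = ≤-trans p≤0 (0≤∣p∣ p)

∑≡sum : ∀ {m} (f : Fin m → ℚ) → ∑ f ≡ sum f
∑≡sum {zero}  f = refl
∑≡sum {suc m} f = cong (f 0F +_) (∑≡sum (f ∘ 1+))

sum-mono-≤ : ∀ {m} {f g : Fin m → ℚ} → (∀ i → f i ≤ g i) → sum f ≤ sum g
sum-mono-≤ {zero}  f≤g = ≤-refl
sum-mono-≤ {suc m} f≤g = +-mono-≤ (f≤g 0F) (sum-mono-≤ (f≤g ∘ 1+))

sum-neg : ∀ {m} (f : Fin m → ℚ) → sum (λ i → - f i) ≡ - sum f
sum-neg {zero}  f = refl
sum-neg {suc m} f = trans (cong (- f 0F +_) (sum-neg (f ∘ 1+))) (sym (neg-distrib-+ (f 0F) _))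

sum[f-g]≡sum[f]-sum[g] : ∀ {m} (f g : Fin m → ℚ) → sum (λ i → f i - g i) ≡ sum f - sum g
sum[f-g]≡sum[f]-sum[g] f g = trans (∑-distrib-+ f (λ i → - g i)) (cong (sum f +_) (sum-neg g))

𝟙 : Bool → ℚ
𝟙 b = if b then 1ℚ else 0ℚ

𝟙-nonNeg : ∀ b → NonNegative (𝟙 b)
𝟙-nonNeg true  = _
𝟙-nonNeg false = _

𝟙-∧ : ∀ a b → 𝟙 (a ∧ b) ≡ 𝟙 b * 𝟙 a
𝟙-∧ true  b = sym (*-identityʳ (𝟙 b))
𝟙-∧ false b = sym (*-zeroʳ (𝟙 b))

sum-𝟙≡count : ∀ {m} (b : Fin m → Bool) → sum (𝟙 ∘ b) ≡ ℕ→ℚ (count b)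
sum-𝟙≡count {zero}  b = refl
sum-𝟙≡count {suc m} b with b 0F
... | true  = trans (cong (1ℚ +_) (sum-𝟙≡count (b ∘ 1+))) (sym (ℕ→ℚ-+ 1 (count (b ∘ 1+))))
... | false = trans (+-identityˡ _) (sum-𝟙≡count (b ∘ 1+))

∣p∣≡count-lookup : ∀ {n} (p : Subset n) → ∣ p ∣ ≡ count (lookup p)
∣p∣≡count-lookup []          = refl
∣p∣≡count-lookup (true  ∷ p) = cong suc (∣p∣≡count-lookup p)
∣p∣≡count-lookup (false ∷ p) = ∣p∣≡count-lookup p

ℕ→ℚ-∣p∩q∣ : ∀ {n} (p q : Subset n) → ℕ→ℚ ∣ p ∩ q ∣ ≡ sum (λ v → 𝟙 (lookup q v) * 𝟙 (lookup p v))
ℕ→ℚ-∣p∩q∣ p q = begin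
  ℕ→ℚ ∣ p ∩ q ∣                                    ≡⟨ cong ℕ→ℚ (∣p∣≡count-lookup (p ∩ q)) ⟩
  ℕ→ℚ (count (lookup (p ∩ q)))                      ≡⟨ sum-𝟙≡count (lookup (p ∩ q)) ⟨
  sum (𝟙 ∘ lookup (p ∩ q))                          ≡⟨ sum-cong-≗ 𝟙-lookup-∩ ⟩
  sum (λ v → 𝟙 (lookup q v) * 𝟙 (lookup p v))       ∎
  where
  open ≡-Reasoning
  𝟙-lookup-∩ : ∀ v → 𝟙 (lookup (p ∩ q) v) ≡ 𝟙 (lookup q v) * 𝟙 (lookup p v)
  𝟙-lookup-∩ v = trans (cong 𝟙 (lookup-zipWith _∧_ v p q)) (𝟙-∧ (lookup p v) (lookup q v))

∣p∪q∣≤∣p∣+∣q∣ : ∀ {n} (p q : Subset n) → ∣ p ∪ q ∣ ℕ.≤ ∣ p ∣ ℕ.+ ∣ q ∣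
∣p∪q∣≤∣p∣+∣q∣ []          []          = z≤n
∣p∪q∣≤∣p∣+∣q∣ (true  ∷ p) (true  ∷ q) = s≤s (ℕ.≤-trans (∣p∪q∣≤∣p∣+∣q∣ p q) (ℕ.+-monoʳ-≤ ∣ p ∣ (ℕ.n≤1+n ∣ q ∣)))
∣p∪q∣≤∣p∣+∣q∣ (true  ∷ p) (false ∷ q) = s≤s (∣p∪q∣≤∣p∣+∣q∣ p q)
∣p∪q∣≤∣p∣+∣q∣ (false ∷ p) (true  ∷ q) = ℕ.≤-trans (s≤s (∣p∪q∣≤∣p∣+∣q∣ p q)) (ℕ.≤-reflexive (sym (ℕ.+-suc ∣ p ∣ ∣ q ∣)))
∣p∪q∣≤∣p∣+∣q∣ (false ∷ p) (false ∷ q) = ∣p∪q∣≤∣p∣+∣q∣ p q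

p─q≡p∩∁q : ∀ {n} (p q : Subset n) → p ─ q ≡ p ∩ ∁ q
p─q≡p∩∁q []      []          = refl
p─q≡p∩∁q (x ∷ p) (true  ∷ q) = cong₂ _∷_ (sym (∧-zeroʳ x)) (p─q≡p∩∁q p q)
p─q≡p∩∁q (x ∷ p) (false ∷ q) = cong₂ _∷_ (sym (∧-identityʳ x)) (p─q≡p∩∁q p q)

∑at : ∀ {n m} → (Fin m → Fin n) → (Fin m → ℚ) → Fin n → ℚ
∑at x f v = ∑ (λ e → if does (x e ≟ v) then f e else 0ℚ)

sum-𝟙*-at : ∀ {n} (z : Fin n → Bool) (u : Fin n) (q : ℚ) →
            sum (λ v → 𝟙 (z v) * (if does (u ≟ v) then q else 0ℚ)) ≡ 𝟙 (z u) * q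
sum-𝟙*-at {suc n} z 0F q = begin
  𝟙 (z 0F) * q + sum (λ v → 𝟙 (z (1+ v)) * 0ℚ)   ≡⟨ cong (𝟙 (z 0F) * q +_) (sum-cong-≗ (λ v → *-zeroʳ (𝟙 (z (1+ v))))) ⟩
  𝟙 (z 0F) * q + sum {n} (λ _ → 0ℚ)               ≡⟨ cong (𝟙 (z 0F) * q +_) (sum-replicate-zero n) ⟩
  𝟙 (z 0F) * q + 0ℚ                               ≡⟨ +-identityʳ _ ⟩
  𝟙 (z 0F) * q                                    ∎
  where open ≡-Reasoning
sum-𝟙*-at {suc n} z (1+ u) q =
  trans (cong₂ _+_ (*-zeroʳ (𝟙 (z 0F))) (sum-𝟙*-at (z ∘ 1+) u q)) (+-identityˡ _)

sum-𝟙*-∑at : ∀ {n m} (z : Fin n → Bool) (x : Fin m → Fin n) (f : Fin m → ℚ) →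
             sum (λ v → 𝟙 (z v) * ∑at x f v) ≡ sum (λ e → 𝟙 (z (x e)) * f e)
sum-𝟙*-∑at z x f = begin
  sum (λ v → 𝟙 (z v) * ∑at x f v)                       ≡⟨ sum-cong-≗ distrib ⟩
  sum (λ v → sum (λ e → 𝟙 (z v) * at v e))               ≡⟨ ∑-comm (λ v e → 𝟙 (z v) * at v e) ⟩
  sum (λ e → sum (λ v → 𝟙 (z v) * at v e))               ≡⟨ sum-cong-≗ (λ e → sum-𝟙*-at z (x e) (f e)) ⟩
  sum (λ e → 𝟙 (z (x e)) * f e)                          ∎
  where
  open ≡-Reasoning
  at : _ → _ → ℚ
  at v e = if does (x e ≟ v) then f e else 0ℚ
  distrib : ∀ v → 𝟙 (z v) * ∑at x f v ≡ sum (λ e → 𝟙 (z v) * at v e)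
  distrib v = trans (cong (𝟙 (z v) *_) (∑≡sum (at v))) (*-distribˡ-sum (𝟙 (z v)) (at v))

sum-𝟙*-netOut : ∀ {n m} (ends : Fin m → Fin n × Fin n) (f : Fin m → ℚ) (z : Fin n → Bool) →
                sum (λ v → 𝟙 (z v) * netOut ends f v)
                ≡ sum (λ e → (𝟙 (z (proj₁ (ends e))) - 𝟙 (z (proj₂ (ends e)))) * f e)
sum-𝟙*-netOut ends f z = begin
  sum (λ v → 𝟙 (z v) * netOut ends f v)                                ≡⟨ sum-cong-≗ (λ v → x[y-z]≈xy-xz (𝟙 (z v)) (out v) (in′ v)) ⟩
  sum (λ v → 𝟙 (z v) * out v - 𝟙 (z v) * in′ v)                        ≡⟨ sum[f-g]≡sum[f]-sum[g] (λ v → 𝟙 (z v) * out v) (λ v → 𝟙 (z v) * in′ v) ⟩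
  sum (λ v → 𝟙 (z v) * out v) - sum (λ v → 𝟙 (z v) * in′ v)            ≡⟨ cong₂ _-_ (sum-𝟙*-∑at z tail f) (sum-𝟙*-∑at z head f) ⟩
  sum (λ e → 𝟙 (z (tail e)) * f e) - sum (λ e → 𝟙 (z (head e)) * f e)  ≡⟨ sum[f-g]≡sum[f]-sum[g] (λ e → 𝟙 (z (tail e)) * f e) (λ e → 𝟙 (z (head e)) * f e) ⟨
  sum (λ e → 𝟙 (z (tail e)) * f e - 𝟙 (z (head e)) * f e)              ≡⟨ sum-cong-≗ (λ e → [y-z]x≈yx-zx (f e) (𝟙 (z (tail e))) (𝟙 (z (head e)))) ⟨
  sum (λ e → (𝟙 (z (tail e)) - 𝟙 (z (head e))) * f e)                  ∎
  where
  open ≡-Reasoning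
  tail head : _ → _
  tail = proj₁ ∘ ends
  head = proj₂ ∘ ends
  out in′ : _ → ℚ
  out = ∑at tail f
  in′ = ∑at head f

𝟙-𝟙*≤𝟙-xor* : ∀ a b {q c} → ℚ.∣ q ∣ ≤ c → (𝟙 a - 𝟙 b) * q ≤ 𝟙 (a xor b) * c
𝟙-𝟙*≤𝟙-xor* true  true  {q} {c} _    = ≤-reflexive (trans (*-zeroˡ q) (sym (*-zeroˡ c)))
𝟙-𝟙*≤𝟙-xor* true  false {q}     ∣q∣≤c = *-monoˡ-≤-nonNeg 1ℚ (≤-trans (p≤∣p∣ q) ∣q∣≤c)
𝟙-𝟙*≤𝟙-xor* false true  {q} {c} ∣q∣≤c = begin
  - 1ℚ * q   ≡⟨ -1*x≈-x q ⟩
  - q        ≤⟨ p≤∣p∣ (- q) ⟩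
  ℚ.∣ - q ∣  ≡⟨ ∣-p∣≡∣p∣ q ⟩
  ℚ.∣ q ∣    ≤⟨ ∣q∣≤c ⟩
  c          ≡⟨ *-identityˡ c ⟨
  1ℚ * c     ∎
  where open ≤-Reasoning
𝟙-𝟙*≤𝟙-xor* false false {q} {c} _    = ≤-reflexive (trans (*-zeroˡ q) (sym (*-zeroˡ c)))

sum-𝟙*-netOut≤cut*c : ∀ {n m} (ends : Fin m → Fin n × Fin n) (f : Fin m → ℚ) {c : ℚ} →
                      (∀ e → ℚ.∣ f e ∣ ≤ c) → (W : Subset n) →
                      sum (λ v → 𝟙 (lookup W v) * netOut ends f v) ≤ ℕ→ℚ (cut ends W) * c
sum-𝟙*-netOut≤cut*c ends f {c} ∣f∣≤c W = begin
  sum (λ v → 𝟙 (w v) * netOut ends f v)                                  ≡⟨ sum-𝟙*-netOut ends f w ⟩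
  sum (λ e → (𝟙 (w (proj₁ (ends e))) - 𝟙 (w (proj₂ (ends e)))) * f e)   ≤⟨ sum-mono-≤ (λ e → 𝟙-𝟙*≤𝟙-xor* (w (proj₁ (ends e))) (w (proj₂ (ends e))) (∣f∣≤c e)) ⟩
  sum (λ e → 𝟙 (crosses e) * c)                                          ≡⟨ *-distribʳ-sum c (𝟙 ∘ crosses) ⟨
  sum (𝟙 ∘ crosses) * c                                                  ≡⟨ cong (_* c) (sum-𝟙≡count crosses) ⟩
  ℕ→ℚ (cut ends W) * c                                                   ∎
  where
  open ≤-Reasoning
  w = lookup W
  crosses : _ → Bool
  crosses e = w (proj₁ (ends e)) xor w (proj₂ (ends e))

count-cong : ∀ {m} {p q : Fin m → Bool} → (∀ i → p i ≡ q i) → count p ≡ count q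
count-cong {zero}  p≗q = refl
count-cong {suc m} p≗q = cong₂ (λ b k → (if b then 1 else 0) ℕ.+ k) (p≗q 0F) (count-cong (p≗q ∘ 1+))

cut-∁ : ∀ {n m} (ends : Fin m → Fin n × Fin n) (U : Subset n) → cut ends (∁ U) ≡ cut ends U
cut-∁ ends U = count-cong λ e → begin
  lookup (∁ U) (proj₁ (ends e)) xor lookup (∁ U) (proj₂ (ends e))  ≡⟨ cong₂ _xor_ (lookup-map _ not U) (lookup-map _ not U) ⟩
  not (u (proj₁ (ends e))) xor not (u (proj₂ (ends e)))          ≡⟨ not-xor-not (u (proj₁ (ends e))) (u (proj₂ (ends e))) ⟩
  u (proj₁ (ends e)) xor u (proj₂ (ends e))                      ∎
  where
  open ≡-Reasoning
  u = lookup U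
  not-xor-not : ∀ x y → not x xor not y ≡ x xor y
  not-xor-not x y = trans (sym (not-distribˡ-xor x (not y)))
                          (trans (cong not (sym (not-distribʳ-xor x y))) (not-involutive (x xor y)))

module _ {n m} {ends : Fin m → Fin n × Fin n} {A C : Subset n} {a c : ℚ} (F : CAFlow ends A C a c) where
  open CAFlow F

  recv≤a*𝟙A : ∀ v → recv v ≤ a * 𝟙 (lookup A v)
  recv≤a*𝟙A v with lookup A v in A[v]
  ... | true  = ≤-trans (recv-≤a v) (≤-reflexive (sym (*-identityʳ a)))
  ... | false = ≤-reflexive (trans (recv-in-A v v∉A) (sym (*-zeroʳ a)))
    where
    v∉A : v ∉ A
    v∉A v∈A with () ← trans (sym ([]=⇒lookup v∈A)) A[v]

  𝟙C≡recv+netOut : ∀ v → 𝟙 (lookup C v) ≡ recv v + netOut ends flow v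
  𝟙C≡recv+netOut v = begin
    𝟙 (lookup C v)                              ≡⟨ solve 2 (λ x r → x := r :+ (x :- r)) refl (𝟙 (lookup C v)) (recv v) ⟩
    recv v + (𝟙 (lookup C v) - recv v)          ≡⟨ cong (recv v +_) (conservation v) ⟨
    recv v + netOut ends flow v                 ∎
    where
    open ≡-Reasoning
    open +-*-Solver

  ∣C∩W∣≤a*∣A∩W∣+cut*c : ∀ W → ℕ→ℚ ∣ C ∩ W ∣ ≤ a * ℕ→ℚ ∣ A ∩ W ∣ + ℕ→ℚ (cut ends W) * c
  ∣C∩W∣≤a*∣A∩W∣+cut*c W = begin
    ℕ→ℚ ∣ C ∩ W ∣                                               ≡⟨ ℕ→ℚ-∣p∩q∣ C W ⟩
    sum (λ v → 𝟙 (w v) * 𝟙 (lookup C v))                        ≡⟨ sum-cong-≗ split ⟩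
    sum (λ v → 𝟙 (w v) * recv v + 𝟙 (w v) * netOut ends flow v) ≡⟨ ∑-distrib-+ (λ v → 𝟙 (w v) * recv v) _ ⟩
    sum (λ v → 𝟙 (w v) * recv v) + sum (λ v → 𝟙 (w v) * netOut ends flow v)
      ≤⟨ +-mono-≤ received-in-W (sum-𝟙*-netOut≤cut*c ends flow congestion W) ⟩
    a * ℕ→ℚ ∣ A ∩ W ∣ + ℕ→ℚ (cut ends W) * c                    ∎
    where
    open ≤-Reasoning
    w = lookup W
    split : ∀ v → 𝟙 (w v) * 𝟙 (lookup C v) ≡ 𝟙 (w v) * recv v + 𝟙 (w v) * netOut ends flow v
    split v = trans (cong (𝟙 (w v) *_) (𝟙C≡recv+netOut v)) (*-distribˡ-+ (𝟙 (w v)) _ _)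
    received-in-W : sum (λ v → 𝟙 (w v) * recv v) ≤ a * ℕ→ℚ ∣ A ∩ W ∣
    received-in-W = begin
      sum (λ v → 𝟙 (w v) * recv v)                   ≤⟨ sum-mono-≤ (λ v → *-monoˡ-≤-nonNeg (𝟙 (w v)) {{𝟙-nonNeg (w v)}} (recv≤a*𝟙A v)) ⟩
      sum (λ v → 𝟙 (w v) * (a * 𝟙 (lookup A v)))     ≡⟨ sum-cong-≗ (λ v → x∙yz≈y∙xz (𝟙 (w v)) a (𝟙 (lookup A v))) ⟩
      sum (λ v → a * (𝟙 (w v) * 𝟙 (lookup A v)))     ≡⟨ *-distribˡ-sum a (λ v → 𝟙 (w v) * 𝟙 (lookup A v)) ⟨
      a * sum (λ v → 𝟙 (w v) * 𝟙 (lookup A v))       ≡⟨ cong (a *_) (ℕ→ℚ-∣p∩q∣ A W) ⟨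
      a * ℕ→ℚ ∣ A ∩ W ∣                              ∎

φ*[X+Y]≤ : ∀ {φ a c X Y δ} → 0ℚ ≤ φ → 0ℚ ≤ a →
           φ * X ≤ δ → Y ≤ a * X + δ * c → φ * (X + Y) ≤ (a + 1ℚ + c * φ) * δ
φ*[X+Y]≤ {φ} {a} {c} {X} {Y} {δ} 0≤φ 0≤a φX≤δ Y≤aX+δc = begin
  φ * (X + Y)                          ≤⟨ *-monoˡ-≤-nonNeg φ {{nonNegative 0≤φ}} (+-monoʳ-≤ X Y≤aX+δc) ⟩
  φ * (X + (a * X + δ * c))            ≡⟨ solve 5 (λ φ a c X δ → φ :* (X :+ (a :* X :+ δ :* c)) := φ :* X :+ a :* (φ :* X) :+ c :* φ :* δ) refl φ a c X δ ⟩
  φ * X + a * (φ * X) + c * φ * δ      ≤⟨ +-monoˡ-≤ (c * φ * δ) (+-mono-≤ φX≤δ (*-monoˡ-≤-nonNeg a {{nonNegative 0≤a}} φX≤δ)) ⟩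
  δ + a * δ + c * φ * δ                ≡⟨ solve 4 (λ a c φ δ → δ :+ a :* δ :+ c :* φ :* δ := (a :+ con 1ℚ :+ c :* φ) :* δ) refl a c φ δ ⟩
  (a + 1ℚ + c * φ) * δ                 ∎
  where
  open ≤-Reasoning
  open +-*-Solver

rate*≤ : ∀ {φ a c} hφ ha hc {k δ} → 0ℚ ≤ δ →
         φ * k ≤ (a + 1ℚ + c * φ) * δ → rate φ a c hφ ha hc * k ≤ δ
rate*≤ {φ} {a} {c} hφ ha hc {k} {δ} 0≤δ φk≤Eδ = begin
  φ * 1/D * k                 ≡⟨ solve 3 (λ φ i k → φ :* i :* k := φ :* k :* i) refl φ 1/D k ⟩
  φ * k * 1/D                 ≤⟨ *-monoʳ-≤-nonNeg 1/D {{1/D-nonNeg}} (≤-trans φk≤Eδ Eδ≤Dδ) ⟩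
  D * δ * 1/D                 ≡⟨ solve 3 (λ D δ i → D :* δ :* i := δ :* (D :* i)) refl D δ 1/D ⟩
  δ * (D * 1/D)               ≡⟨ cong (δ *_) (*-inverseʳ D {{D≢0}}) ⟩
  δ * 1ℚ                      ≡⟨ *-identityʳ δ ⟩
  δ                           ∎
  where
  open ≤-Reasoning
  open +-*-Solver
  E D 1/D : ℚ
  E = a + 1ℚ + c * φ
  D = denom φ a c
  D-pos = denom-pos φ a c hφ ha hc
  D≢0 = pos⇒nonZero D {{D-pos}}
  1/D = (1/ D) {{D≢0}}
  1/D-nonNeg = pos⇒nonNeg 1/D {{1/pos⇒pos D {{D-pos}}}}
  0≤E : 0ℚ ≤ E
  0≤E = +-mono-≤ (+-mono-≤ ha (nonNegative⁻¹ 1ℚ))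
                 (nonNegative⁻¹ (c * φ) {{nonNeg*nonNeg⇒nonNeg c {{nonNegative hc}} φ {{nonNegative hφ}}}})
  E≤D : E ≤ D
  E≤D = begin
    E           ≡⟨ +-identityʳ E ⟨
    E + 0ℚ      ≤⟨ +-monoʳ-≤ E 0≤E ⟩
    E + E       ≡⟨ solve 1 (λ E → E :+ E := con (ℤ.+ 2 / 1) :* E) refl E ⟩
    D           ∎
  Eδ≤Dδ : E * δ ≤ D * δ
  Eδ≤Dδ = *-monoʳ-≤-nonNeg δ {{nonNegative 0≤δ}} E≤D

rate*≤cut : ∀ {n m} {ends : Fin m → Fin n × Fin n} {A C : Subset n} {φ a c : ℚ} hφ ha hc →
            CAFlow ends A C a c → (W : Subset n) {k : ℕ} →
            φ * ℕ→ℚ ∣ A ∩ W ∣ ≤ ℕ→ℚ (cut ends W) → k ℕ.≤ ∣ (A ∪ C) ∩ W ∣ →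
            rate φ a c hφ ha hc * ℕ→ℚ k ≤ ℕ→ℚ (cut ends W)
rate*≤cut {ends = ends} {A} {C} {φ} {a} {c} hφ ha hc F W {k} φ∣A∩W∣≤cut k≤ =
  rate*≤ hφ ha hc (ℕ→ℚ-nonNeg (cut ends W)) (begin
    φ * ℕ→ℚ k                                    ≤⟨ *-monoˡ-≤-nonNeg φ {{nonNegative hφ}} (ℕ→ℚ-mono-≤ k≤∣A∩W∣+∣C∩W∣) ⟩
    φ * ℕ→ℚ (∣ A ∩ W ∣ ℕ.+ ∣ C ∩ W ∣)             ≡⟨ cong (φ *_) (ℕ→ℚ-+ ∣ A ∩ W ∣ ∣ C ∩ W ∣) ⟩
    φ * (ℕ→ℚ ∣ A ∩ W ∣ + ℕ→ℚ ∣ C ∩ W ∣)           ≤⟨ φ*[X+Y]≤ hφ ha φ∣A∩W∣≤cut (∣C∩W∣≤a*∣A∩W∣+cut*c F W) ⟩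
    (a + 1ℚ + c * φ) * ℕ→ℚ (cut ends W)          ∎)
  where
  open ≤-Reasoning
  k≤∣A∩W∣+∣C∩W∣ : k ℕ.≤ ∣ A ∩ W ∣ ℕ.+ ∣ C ∩ W ∣
  k≤∣A∩W∣+∣C∩W∣ = ℕ.≤-trans k≤ (ℕ.≤-trans (ℕ.≤-reflexive (cong ∣_∣ (∩-distribʳ-∪ W A C)))
                                            (∣p∪q∣≤∣p∣+∣q∣ (A ∩ W) (C ∩ W)))

α*⊓≤cut : ∀ {n m} {ends : Fin m → Fin n × Fin n} {α : ℚ} {A : Subset n} →
          Expands ends α A → ∀ U → α * ℕ→ℚ (∣ A ∩ U ∣ ⊓ ∣ A ─ U ∣) ≤ ℕ→ℚ (cut ends U)
α*⊓≤cut {ends = ends} {α} {A} expands U with ∣ A ∩ U ∣ ⊓ ∣ A ─ U ∣ | expands U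
... | zero  | _     = ≤-trans (≤-reflexive (*-zeroʳ α)) (ℕ→ℚ-nonNeg (cut ends U))
... | suc _ | bound = bound (s≤s z≤n)

lemma4p3 : (n m : ℕ) (ends : Fin m → Fin n × Fin n) (A C : Subset n) (φ a c : ℚ)
           (hφ : 0ℚ ≤ φ) (ha : 0ℚ ≤ a) (hc : 0ℚ ≤ c) →
           Expands ends φ A →
           CAFlow ends A C a c →
           Expands ends (rate φ a c hφ ha hc) (A ∪ C)
lemma4p3 n m ends A C φ a c hφ ha hc expands F U _ with ℕ.≤-total ∣ A ∩ U ∣ ∣ A ─ U ∣
... | inj₁ ∩≤─ = rate*≤cut hφ ha hc F U φ∣A∩U∣≤cut (ℕ.m⊓n≤m ∣ (A ∪ C) ∩ U ∣ ∣ (A ∪ C) ─ U ∣)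
  where
  φ∣A∩U∣≤cut : φ * ℕ→ℚ ∣ A ∩ U ∣ ≤ ℕ→ℚ (cut ends U)
  φ∣A∩U∣≤cut = subst (λ x → φ * ℕ→ℚ x ≤ ℕ→ℚ (cut ends U)) (ℕ.m≤n⇒m⊓n≡m ∩≤─) (α*⊓≤cut {ends = ends} {φ} {A} expands U)
... | inj₂ ─≤∩ = begin
  rate φ a c hφ ha hc * ℕ→ℚ k   ≤⟨ rate*≤cut hφ ha hc F (∁ U) φ∣A∩∁U∣≤cut k≤∣[A∪C]∩∁U∣ ⟩
  ℕ→ℚ (cut ends (∁ U))          ≡⟨ cong ℕ→ℚ (cut-∁ ends U) ⟩
  ℕ→ℚ (cut ends U)              ∎
  where
  open ≤-Reasoning
  k = ∣ (A ∪ C) ∩ U ∣ ⊓ ∣ (A ∪ C) ─ U ∣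
  ∣X─U∣≡∣X∩∁U∣ : ∀ X → ∣ X ─ U ∣ ≡ ∣ X ∩ ∁ U ∣
  ∣X─U∣≡∣X∩∁U∣ X = cong ∣_∣ (p─q≡p∩∁q X U)
  φ∣A∩∁U∣≤cut : φ * ℕ→ℚ ∣ A ∩ ∁ U ∣ ≤ ℕ→ℚ (cut ends (∁ U))
  φ∣A∩∁U∣≤cut = subst₂ (λ x δ → φ * ℕ→ℚ x ≤ ℕ→ℚ δ) (trans (ℕ.m≥n⇒m⊓n≡n ─≤∩) (∣X─U∣≡∣X∩∁U∣ A)) (sym (cut-∁ ends U))
                       (α*⊓≤cut {ends = ends} {φ} {A} expands U)
  k≤∣[A∪C]∩∁U∣ : k ℕ.≤ ∣ (A ∪ C) ∩ ∁ U ∣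
  k≤∣[A∪C]∩∁U∣ = subst (k ℕ.≤_) (∣X─U∣≡∣X∩∁U∣ (A ∪ C)) (ℕ.m⊓n≤n ∣ (A ∪ C) ∩ U ∣ ∣ (A ∪ C) ─ U ∣)
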